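{- Let $G$ be a connected finite simple graph with no induced subgraph isomorphic to the path $P_4$ on four vertices, and let $S\subseteq V(G)$ be a cutset of $G$ such that each vertex of $S$ is adjacent to vertices in at least two distinct components of $G-S$. Then: (i) For each $u\in S$ and each component $R$ of $G-S$, if $u$ is adjacent to some vertex of $R$ then $u$ is adjacent to every vertex of $R$. (ii) If $R$ is a component of $G-S$ and $G'$ is the (simple) graph obtained from $G$ by contracting $R$ into a single vertex, then $G'$ has no induced $P_4$. (iii) If $S$ is a minimal cutset of $G$, then $G[S, V(G)-S]$ is a complete bipartite graph, i.e., every vertex of $S$ is adjacent to every vertex of $V(G)-S$. (iv) If $S$ is not a minimal cutset of $G$, then there exist a cutset $U\subseteq S$ of $G$, a nonempty set $X\subseteq S-U$ and a nonempty set $Y\subseteq V(G)-S$ such that (a) the induced subgraph on $X\cup Y$ is a component of $G-U$, and (b) $G[U,X,Y]$ is a complete tripartite graph.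
   Context: A cutset of $G$ is a set $S\subseteq V(G)$ such that $G-S$ (the subgraph induced on $V(G)-S$) is disconnected; it is minimal if no proper subset is a cutset. For disjoint nonempty sets $X_1,\dots,X_k\subseteq V(G)$, $G[X_1,\dots,X_k]$ denotes the $k$-partite subgraph with vertex set $X_1\cup\dots\cup X_k$ and edge set $\{uv\in E(G): u\in X_i, v\in X_j, 1\le i<j\le k\}$. -}

module Defs where

open import Data.Nat using (ℕ)
open import Data.Bool using (Bool; true; false; T)
open import Data.Fin using (Fin)
open import Data.Fin.Subset using (Subset; _∈_; _∉_; _⊆_; ∁; ⊤; _∪_; Nonempty)
open import Data.Maybe using (Maybe; just; nothing)
open import Data.Empty renaming (⊥ to Empty)
open import Data.Unit renaming (⊤ to Unit)
open import Data.Product using (Σ; ∃; _×_; _,_)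
open import Relation.Nullary using (¬_)
open import Relation.Binary.PropositionalEquality using (_≡_; _≢_)

record Graph (n : ℕ) : Set where
  field
    adj    : Fin n → Fin n → Bool
    sym    : ∀ x y → adj x y ≡ adj y x
    irrefl : ∀ x → adj x x ≡ false

module _ {n : ℕ} (G : Graph n) where
  open Graph G

  E : Fin n → Fin n → Set
  E x y = T (adj x y)

  data Path (W : Subset n) : Fin n → Fin n → Set where
    here : ∀ {x} → x ∈ W → Path W x x
    step : ∀ {x y z} → Path W x y → E y z → z ∈ W → Path W x z

  Connected : Set
  Connected = ∀ x y → Path ⊤ x y

  Cutset : Subset n → Set
  Cutset S = Σ (Fin n) λ x → Σ (Fin n) λ y →
    x ∉ S × y ∉ S × ¬ Path (∁ S) x y

  MinimalCutset : Subset n → Set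
  MinimalCutset S = Cutset S × (∀ T → T ⊆ S → T ≢ S → ¬ Cutset T)

  -- R is (the vertex set of) a connected component of G[W]:
  -- a nonempty subset of W inducing a connected subgraph, with no edges
  -- from R to W - R (i.e. a maximal connected subgraph of G[W]).
  Component : Subset n → Subset n → Set
  Component W R =
    R ⊆ W × Nonempty R × (∀ x y → x ∈ R → y ∈ R → Path R x y) ×
    (∀ x y → x ∈ R → y ∈ W → y ∉ R → ¬ E x y)

  AdjTo : Fin n → Subset n → Set
  AdjTo u R = Σ (Fin n) λ v → v ∈ R × E u v

HasInducedP4 : {V : Set} → (V → Set) → (V → V → Set) → Set
HasInducedP4 {V} In A = Σ V λ a → Σ V λ b → Σ V λ c → Σ V λ d →
  In a × In b × In c × In d ×
  a ≢ b × a ≢ c × a ≢ d × b ≢ c × b ≢ d × c ≢ d ×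
  A a b × A b c × A c d × ¬ A a c × ¬ A a d × ¬ A b d

P4Free : {n : ℕ} → Graph n → Set
P4Free G = ¬ HasInducedP4 (λ _ → Unit) (E G)

-- The simple graph obtained from G by contracting the vertex set R into a
-- single new vertex: vertices are `nothing` (the new vertex) and `just v`
-- for v ∉ R; the new vertex is adjacent to v iff v has a neighbour in R.
ContrIn : {n : ℕ} → Subset n → Maybe (Fin n) → Set
ContrIn R nothing  = Unit
ContrIn R (just v) = v ∉ R

ContrAdj : {n : ℕ} → Graph n → Subset n → Maybe (Fin n) → Maybe (Fin n) → Set
ContrAdj G R nothing  nothing  = Empty
ContrAdj G R nothing  (just y) = AdjTo G y R
ContrAdj G R (just x) nothing  = AdjTo G x R
ContrAdj G R (just x) (just y) = E G x y

ContractedP4Free : {n : ℕ} → Graph n → Subset n → Set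
ContractedP4Free G R = ¬ HasInducedP4 (ContrIn R) (ContrAdj G R)

-- For u ∈ S let N∁ u be the set of neighbours of u outside S.  P4-freeness makes
-- N∁ u closed under the edges of G − S: if u ~ a ~ b with a, b ∉ S and u ≁ b,
-- choose a component R seen by u that avoids a and a neighbour z ∈ R of u; then
-- b–a–u–z is an induced P4.  So N∁ u is a union of components, which is (i), and
-- by (i) contracting a component R yields the induced subgraph G − (R − r) for
-- any r ∈ R, which is (ii).  Two more induced P4s show that for x, u ∈ S the sets
-- N∁ x and N∁ u are comparable when x ~ u, and N∁ x ⊆ N∁ u when x ≁ u share an
-- outside neighbour.  Now let x₀ ∈ S miss some vertex outside S, with N∁ x₀
-- ⊂-minimal among such vertices; put Y = N∁ x₀, X = {x ∈ S ∣ N∁ x = Y} and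
-- U = {u ∈ S ∣ Y ⊂ N∁ u}.  The comparability facts show that X ∪ Y is a component
-- of G − U, hence U is a cutset, and that U, X, Y are completely joined.  This
-- gives (iv), and also (iii), since x₀ ∈ S − U.  When no such x₀ exists, S is
-- minimal: for T ⊂ S every vertex of G − T reaches a vertex of S − T.

module Submission where

open import Defs
open import Level using (Level)
open import Data.Nat using (ℕ)
open import Data.Bool using (T) renaming (_≟_ to _≟ᵇ_)
open import Data.Fin using (Fin)
open import Data.Fin.Properties using (any?)
open import Data.Fin.Subset using (Subset; _∈_; _∉_; _⊆_; _⊈_; _⊂_; ∁; _∪_; _∩_; Nonempty; Empty)
open import Data.Fin.Subset.Properties
  using (_∈?_; _⊆?_; _⊂?_; ⊆-antisym; ⊂-irref; x∈∁p⇒x∉p; x∉p⇒x∈∁p; x∈p∪q⁺; x∈p∪q⁻; x∈p∩q⁺; x∈p∩q⁻)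
open import Data.Fin.Subset.Induction using (⊂-wellFounded; Acc; acc)
open import Data.Maybe using (Maybe; just; nothing)
open import Data.Vec using (tabulate)
open import Data.Vec.Properties using (lookup∘tabulate; []=⇒lookup; lookup⇒[]=; ≡-dec)
open import Data.Product using (Σ; ∃; _×_; _,_; proj₁; proj₂)
open import Data.Sum using (inj₁; inj₂)
open import Data.Empty using (⊥; ⊥-elim)
open import Function using (_∘_)
open import Relation.Unary using (Pred; Decidable)
open import Relation.Nullary using (¬_; Dec; yes; no; does; contradiction)
open import Relation.Nullary.Decidable using (T?; ¬?; _×-dec_; dec-true; decidable-stable)
open import Relation.Binary.PropositionalEquality using (_≡_; _≢_; refl; sym; trans; subst)

private
  variable
    ℓ : Level
    n m : ℕ
    P Q R W : Subset n
    a b c d r u v w x y z : Fin n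

fromDec : {A : Pred (Fin n) ℓ} → Decidable A → Subset n
fromDec A? = tabulate (does ∘ A?)

module _ {A : Pred (Fin n) ℓ} (A? : Decidable A) where

  ∈-fromDec⁺ : A x → x ∈ fromDec A?
  ∈-fromDec⁺ {x} ax = lookup⇒[]= x _ (trans (lookup∘tabulate _ x) (dec-true (A? x) ax))

  ∈-fromDec⁻ : x ∈ fromDec A? → A x
  ∈-fromDec⁻ {x} x∈ with A? x | trans (sym (lookup∘tabulate (does ∘ A?) x)) ([]=⇒lookup x∈)
  ... | yes ax | _ = ax
  ... | no _   | ()

⊈⇒∃∉ : P ⊈ Q → ∃ λ x → x ∈ P × x ∉ Q
⊈⇒∃∉ {P = P} {Q} P⊈Q with any? (λ x → x ∈? P ×-dec ¬? (x ∈? Q))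
... | yes witness = witness
... | no ∄ = contradiction (λ {x} x∈P → decidable-stable (x ∈? Q) (λ x∉Q → ∄ (x , x∈P , x∉Q))) P⊈Q

⊆∧≢⇒⊂ : P ⊆ Q → P ≢ Q → P ⊂ Q
⊆∧≢⇒⊂ {P = P} {Q} P⊆Q P≢Q with Q ⊆? P
... | yes Q⊆P = contradiction (⊆-antisym P⊆Q Q⊆P) P≢Q
... | no Q⊈P = P⊆Q , ⊈⇒∃∉ Q⊈P

∃-⊂-minimal : {A : Pred (Fin n) ℓ} → Decidable A → (f : Fin n → Subset m) → ∃ A →
  ∃ λ x → A x × ∀ y → A y → ¬ f y ⊂ f x
∃-⊂-minimal {A = A} A? f (x , ax) = go x ax (⊂-wellFounded (f x))
  where
  go : ∀ x → A x → Acc _⊂_ (f x) → ∃ λ x → A x × ∀ y → A y → ¬ f y ⊂ f x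
  go x ax (acc smaller) with any? (λ y → A? y ×-dec f y ⊂? f x)
  ... | yes (y , ay , fy⊂fx) = go y ay (smaller fy⊂fx)
  ... | no ∄ = x , ax , λ y ay fy⊂fx → ∄ (y , ay , fy⊂fx)

module _ (G : Graph n) where

  E? : ∀ x y → Dec (E G x y)
  E? x y = T? (Graph.adj G x y)

  E-sym : E G x y → E G y x
  E-sym {x} {y} = subst T (Graph.sym G x y)

  E-irrefl : ¬ E G x x
  E-irrefl {x} = subst T (Graph.irrefl G x)

  Path-end : Path G W x y → y ∈ W
  Path-end (here y∈W)     = y∈W
  Path-end (step _ _ y∈W) = y∈W

  Path-trans : Path G W x y → Path G W y z → Path G W x z
  Path-trans p (here _)       = p
  Path-trans p (step q e z∈W) = step (Path-trans p q) e z∈W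

  Path-sym : Path G W x y → Path G W y x
  Path-sym (here x∈W)     = here x∈W
  Path-sym (step p e y∈W) = Path-trans (step (here y∈W) (E-sym e) (Path-end p)) (Path-sym p)

  Path-preserves : (A : Pred (Fin n) ℓ) → (∀ {a b} → A a → b ∈ W → E G a b → A b) →
    Path G W x y → A x → A y
  Path-preserves A closed (here _)       ax = ax
  Path-preserves A closed (step p e y∈W) ax = closed (Path-preserves A closed p ax) y∈W e

  Component-closed : Component G W R → a ∈ R → b ∈ W → E G a b → b ∈ R
  Component-closed {R = R} {b = b} (_ , _ , _ , no-exit) a∈R b∈W ab with b ∈? R
  ... | yes b∈R = b∈R
  ... | no b∉R  = contradiction ab (no-exit _ _ a∈R b∈W b∉R)

  Component-¬Path : Component G W R → x ∈ R → y ∉ R → ¬ Path G W x y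
  Component-¬Path {R = R} cR x∈R y∉R p =
    y∉R (Path-preserves (_∈ R) (Component-closed cR) p x∈R)

  Component-unique : Component G W P → Component G W Q → x ∈ P → x ∈ Q → P ≡ Q
  Component-unique cP cQ x∈P x∈Q = ⊆-antisym (included cP cQ x∈P x∈Q) (included cQ cP x∈Q x∈P)
    where
    included : Component G W P → Component G W Q → x ∈ P → x ∈ Q → P ⊆ Q
    included {Q = Q} (P⊆W , _ , connected , _) cQ x∈P x∈Q y∈P =
      Path-preserves (_∈ Q) (λ a∈Q b∈P → Component-closed cQ a∈Q (P⊆W b∈P)) (connected _ _ x∈P y∈P) x∈Q

  -- The six distinctness conditions of an induced P4 follow from its edges and non-edges.
  P4Free-chord : P4Free G → E G a b → E G b c → E G c d →
    ¬ E G a c → ¬ E G a d → ¬ E G b d → ⊥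
  P4Free-chord {a} {b} {c} {d} p4 ab bc cd ¬ac ¬ad ¬bd =
    p4 (a , b , c , d , _ , _ , _ , _ ,
        (λ { refl → E-irrefl ab }) , (λ { refl → ¬ad cd }) , (λ { refl → ¬ac (E-sym cd) }) ,
        (λ { refl → E-irrefl bc }) , (λ { refl → ¬ad ab }) , (λ { refl → E-irrefl cd }) ,
        ab , bc , cd , ¬ac , ¬ad , ¬bd)

  contraction-P4Free : P4Free G → r ∈ R → (∀ {y} → y ∉ R → AdjTo G y R → E G y r) →
    ContractedP4Free G R
  contraction-P4Free {r = r} {R = R} p4 r∈R adj⇒r
    (a , b , c , d , ia , ib , ic , id , _ , _ , _ , _ , _ , _ , ab , bc , cd , ¬ac , ¬ad , ¬bd) =
    P4Free-chord p4 (to ia ib ab) (to ib ic bc) (to ic id cd)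
      (¬ac ∘ from a c) (¬ad ∘ from a d) (¬bd ∘ from b d)
    where
    vertex : Maybe (Fin n) → Fin n
    vertex nothing  = r
    vertex (just v) = v

    to : ∀ {p q} → ContrIn R p → ContrIn R q → ContrAdj G R p q → E G (vertex p) (vertex q)
    to {nothing} {just y} _   y∉R adj = E-sym (adj⇒r y∉R adj)
    to {just x} {nothing} x∉R _   adj = adj⇒r x∉R adj
    to {just x} {just y}  _   _   xy  = xy

    from : ∀ p q → E G (vertex p) (vertex q) → ContrAdj G R p q
    from nothing  nothing  rr = E-irrefl rr
    from nothing  (just y) ry = r , r∈R , E-sym ry
    from (just x) nothing  xr = r , r∈R , xr
    from (just x) (just y) xy = xy

SeesTwoComponents : Graph n → Subset n → Set
SeesTwoComponents {n} G S = ∀ u → u ∈ S → Σ (Subset n) λ R₁ → Σ (Subset n) λ R₂ →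
  Component G (∁ S) R₁ × Component G (∁ S) R₂ × R₁ ≢ R₂ × AdjTo G u R₁ × AdjTo G u R₂

TripartiteSplit : Graph n → Subset n → Set
TripartiteSplit {n} G S = Σ (Subset n) λ U → Σ (Subset n) λ X → Σ (Subset n) λ Y →
  U ⊆ S × Cutset G U ×
  Nonempty X × X ⊆ S × Empty (X ∩ U) ×
  Nonempty Y × Y ⊆ ∁ S ×
  Component G (∁ U) (X ∪ Y) ×
  (∀ u x → u ∈ U → x ∈ X → E G u x) ×
  (∀ u y → u ∈ U → y ∈ Y → E G u y) ×
  (∀ x y → x ∈ X → y ∈ Y → E G x y)

split⇒¬minimal : (G : Graph n) (S : Subset n) → TripartiteSplit G S → ¬ MinimalCutset G S
split⇒¬minimal G S (U , X , _ , U⊆S , U-cutset , (x , x∈X) , X⊆S , X∩U-empty , _) (_ , minimality) =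
  minimality U U⊆S U≢S U-cutset
  where
  U≢S : U ≢ S
  U≢S U≡S = X∩U-empty (x , x∈p∩q⁺ (x∈X , subst (x ∈_) (sym U≡S) (X⊆S x∈X)))

module P4FreeCutset (G : Graph n) (S : Subset n) (p4 : P4Free G) (sees-two : SeesTwoComponents G S) where

  N∁? : ∀ u v → Dec (v ∉ S × E G u v)
  N∁? u v = ¬? (v ∈? S) ×-dec E? G u v

  N∁ : Fin n → Subset n
  N∁ u = fromDec (N∁? u)

  ∈-N∁⁺ : v ∉ S → E G u v → v ∈ N∁ u
  ∈-N∁⁺ {u = u} v∉S uv = ∈-fromDec⁺ (N∁? u) (v∉S , uv)

  ∈-N∁⁻ : v ∈ N∁ u → v ∉ S × E G u v
  ∈-N∁⁻ {u = u} = ∈-fromDec⁻ (N∁? u)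

  out-neighbour : u ∈ S → Nonempty (N∁ u)
  out-neighbour u∈S with sees-two _ u∈S
  ... | _ , _ , (R⊆∁S , _) , _ , _ , (z , z∈R , uz) , _ = z , ∈-N∁⁺ (x∈∁p⇒x∉p (R⊆∁S z∈R)) uz

  N∁-closed-avoiding : Component G (∁ S) R → AdjTo G u R → a ∉ R →
    a ∈ N∁ u → b ∉ S → E G a b → b ∈ N∁ u
  N∁-closed-avoiding {u = u} {a = a} {b = b} cR (z , z∈R , uz) a∉R a∈N∁u b∉S ab with E? G u b
  ... | yes ub = ∈-N∁⁺ b∉S ub
  ... | no ¬ub = ⊥-elim (P4Free-chord G p4 (E-sym G ab) (E-sym G ua) uz (¬ub ∘ E-sym G) ¬bz ¬az)
    where
    a∉S = proj₁ (∈-N∁⁻ a∈N∁u)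
    ua  = proj₂ (∈-N∁⁻ a∈N∁u)
    ¬az : ¬ E G a z
    ¬az az = a∉R (Component-closed G cR z∈R (x∉p⇒x∈∁p a∉S) (E-sym G az))
    ¬bz : ¬ E G b z
    ¬bz bz = a∉R (Component-closed G cR (Component-closed G cR z∈R (x∉p⇒x∈∁p b∉S) (E-sym G bz))
                   (x∉p⇒x∈∁p a∉S) (E-sym G ab))

  N∁-closed : u ∈ S → a ∈ N∁ u → b ∉ S → E G a b → b ∈ N∁ u
  N∁-closed {a = a} u∈S a∈N∁u b∉S ab with sees-two _ u∈S
  ... | R₁ , R₂ , c₁ , c₂ , R₁≢R₂ , adj₁ , adj₂ with a ∈? R₁ | a ∈? R₂
  ...   | no a∉R₁  | _         = N∁-closed-avoiding c₁ adj₁ a∉R₁ a∈N∁u b∉S ab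
  ...   | yes _    | no a∉R₂   = N∁-closed-avoiding c₂ adj₂ a∉R₂ a∈N∁u b∉S ab
  ...   | yes a∈R₁ | yes a∈R₂  = contradiction (Component-unique G c₁ c₂ a∈R₁ a∈R₂) R₁≢R₂

  adjacent⇒complete-to-component : u ∈ S → Component G (∁ S) R → AdjTo G u R → w ∈ R → E G u w
  adjacent⇒complete-to-component {u = u} {R = R} u∈S (R⊆∁S , _ , connected , _) (v , v∈R , uv) w∈R =
    proj₂ (∈-N∁⁻ (Path-preserves G (_∈ N∁ u) extend (connected _ _ v∈R w∈R) (∈-N∁⁺ (∉S v∈R) uv)))
    where
    ∉S : x ∈ R → x ∉ S
    ∉S = x∈∁p⇒x∉p ∘ R⊆∁S
    extend : a ∈ N∁ u → b ∈ R → E G a b → b ∈ N∁ u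
    extend a∈N∁u b∈R = N∁-closed u∈S a∈N∁u (∉S b∈R)

  component-contraction-P4Free : Component G (∁ S) R → ContractedP4Free G R
  component-contraction-P4Free {R = R} cR@(_ , (r , r∈R) , _) = contraction-P4Free G p4 r∈R adj⇒r
    where
    adj⇒r : y ∉ R → AdjTo G y R → E G y r
    adj⇒r {y} y∉R adj@(z , z∈R , yz) with y ∈? S
    ... | yes y∈S = adjacent⇒complete-to-component y∈S cR adj r∈R
    ... | no y∉S  = contradiction (Component-closed G cR z∈R (x∉p⇒x∈∁p y∉S) (E-sym G yz)) y∉R

  adjacent⇒N∁-comparable : x ∈ S → E G x u → r ∈ N∁ x → r ∉ N∁ u → N∁ u ⊆ N∁ x
  adjacent⇒N∁-comparable {x = x} {u = u} {r = r} x∈S xu r∈N∁x r∉N∁u {r′} r′∈N∁u with r′ ∈? N∁ x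
  ... | yes r′∈N∁x = r′∈N∁x
  ... | no r′∉N∁x  = ⊥-elim (P4Free-chord G p4 (E-sym G xr) xu ur′ ¬ru ¬rr′ ¬xr′)
    where
    r∉S  = proj₁ (∈-N∁⁻ r∈N∁x)
    xr   = proj₂ (∈-N∁⁻ r∈N∁x)
    r′∉S = proj₁ (∈-N∁⁻ r′∈N∁u)
    ur′  = proj₂ (∈-N∁⁻ r′∈N∁u)
    ¬ru : ¬ E G r u
    ¬ru ru = r∉N∁u (∈-N∁⁺ r∉S (E-sym G ru))
    ¬rr′ : ¬ E G r r′
    ¬rr′ rr′ = r′∉N∁x (N∁-closed x∈S r∈N∁x r′∉S rr′)
    ¬xr′ : ¬ E G x r′
    ¬xr′ xr′ = r′∉N∁x (∈-N∁⁺ r′∉S xr′)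

  nonadjacent⇒N∁-⊆ : u ∈ S → ¬ E G x u → r ∈ N∁ x → r ∈ N∁ u → N∁ x ⊆ N∁ u
  nonadjacent⇒N∁-⊆ {u = u} {x = x} {r = r} u∈S ¬xu r∈N∁x r∈N∁u {r′} r′∈N∁x with r′ ∈? N∁ u
  ... | yes r′∈N∁u = r′∈N∁u
  ... | no r′∉N∁u  = ⊥-elim (P4Free-chord G p4 (E-sym G xr′) xr (E-sym G ur) ¬r′r ¬r′u ¬xu)
    where
    xr   = proj₂ (∈-N∁⁻ r∈N∁x)
    ur   = proj₂ (∈-N∁⁻ r∈N∁u)
    r′∉S = proj₁ (∈-N∁⁻ r′∈N∁x)
    xr′  = proj₂ (∈-N∁⁻ r′∈N∁x)
    ¬r′r : ¬ E G r′ r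
    ¬r′r r′r = r′∉N∁u (N∁-closed u∈S r∈N∁u r′∉S (E-sym G r′r))
    ¬r′u : ¬ E G r′ u
    ¬r′u r′u = r′∉N∁u (∈-N∁⁺ r′∉S (E-sym G r′u))

  Deficient : Fin n → Set
  Deficient x = x ∈ S × ∃ λ v → v ∉ S × ¬ E G x v

  Deficient? : ∀ x → Dec (Deficient x)
  Deficient? x = x ∈? S ×-dec any? (λ v → ¬? (v ∈? S) ×-dec ¬? (E? G x v))

  ¬Deficient⇒minimal : Cutset G S → (∀ x → ¬ Deficient x) → MinimalCutset G S
  ¬Deficient⇒minimal cutset none = cutset , proper-not-cutset
    where
    full : x ∈ S → v ∉ S → E G x v
    full {x} {v} x∈S v∉S = decidable-stable (E? G x v) (λ ¬xv → none x (x∈S , v , v∉S , ¬xv))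

    proper-not-cutset : ∀ T → T ⊆ S → T ≢ S → ¬ Cutset G T
    proper-not-cutset T T⊆S T≢S (a , b , a∉T , b∉T , ¬path)
      with ⊈⇒∃∉ (λ S⊆T → T≢S (⊆-antisym T⊆S S⊆T))
    ... | t , t∈S , t∉T = ¬path (Path-trans G (reach a∉T) (Path-sym G (reach b∉T)))
      where
      ∉T : c ∉ S → c ∈ ∁ T
      ∉T c∉S = x∉p⇒x∈∁p (c∉S ∘ T⊆S)

      reach : c ∉ T → Path G (∁ T) c t
      reach {c} c∉T with c ∈? S
      ... | no c∉S = step (here (x∉p⇒x∈∁p c∉T)) (E-sym G (full t∈S c∉S)) (x∉p⇒x∈∁p t∉T)
      ... | yes c∈S with out-neighbour c∈S
      ...   | z , z∈N∁c = step (step (here (x∉p⇒x∈∁p c∉T)) (proj₂ (∈-N∁⁻ z∈N∁c)) (∉T z∉S))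
                            (E-sym G (full t∈S z∉S)) (x∉p⇒x∈∁p t∉T)
        where z∉S = proj₁ (∈-N∁⁻ z∈N∁c)

  module Split (x₀ : Fin n) (x₀-deficient : Deficient x₀)
               (x₀-minimal : ∀ y → Deficient y → ¬ N∁ y ⊂ N∁ x₀) where

    Y : Subset n
    Y = N∁ x₀

    X? : ∀ w → Dec (w ∈ S × N∁ w ≡ Y)
    X? w = w ∈? S ×-dec ≡-dec _≟ᵇ_ (N∁ w) Y

    U? : ∀ w → Dec (w ∈ S × Y ⊂ N∁ w)
    U? w = w ∈? S ×-dec Y ⊂? N∁ w

    X U C : Subset n
    X = fromDec X?
    U = fromDec U?
    C = X ∪ Y

    x₀∈S : x₀ ∈ S
    x₀∈S = proj₁ x₀-deficient

    x₀∈X : x₀ ∈ X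
    x₀∈X = ∈-fromDec⁺ X? (x₀∈S , refl)

    y₀ : Fin n
    y₀ = proj₁ (out-neighbour x₀∈S)

    y₀∈Y : y₀ ∈ Y
    y₀∈Y = proj₂ (out-neighbour x₀∈S)

    N∁≡Y : w ∈ X → N∁ w ≡ Y
    N∁≡Y = proj₂ ∘ ∈-fromDec⁻ X?

    Y⊂N∁ : u ∈ U → Y ⊂ N∁ u
    Y⊂N∁ = proj₂ ∘ ∈-fromDec⁻ U?

    X∩U-empty : Empty (X ∩ U)
    X∩U-empty (w , w∈X∩U) with x∈p∩q⁻ X U w∈X∩U
    ... | w∈X , w∈U = ⊂-irref (sym (N∁≡Y w∈X)) (Y⊂N∁ w∈U)

    adjacent-to-X⇒covers-Y : a ∈ X → b ∈ S → E G a b → Y ⊆ N∁ b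
    adjacent-to-X⇒covers-Y {a} {b} a∈X b∈S ab {r} r∈Y with r ∈? N∁ b
    ... | yes r∈N∁b = r∈N∁b
    ... | no r∉N∁b  = contradiction ((λ {w} → N∁b⊆Y {w}) , r , r∈Y , r∉N∁b) (x₀-minimal b (b∈S , r , r∉S , ¬br))
      where
      r∉S = proj₁ (∈-N∁⁻ r∈Y)
      ¬br : ¬ E G b r
      ¬br br = r∉N∁b (∈-N∁⁺ r∉S br)
      N∁b⊆Y : N∁ b ⊆ Y
      N∁b⊆Y = subst (N∁ b ⊆_) (N∁≡Y a∈X)
        (adjacent⇒N∁-comparable (proj₁ (∈-fromDec⁻ X? a∈X)) ab (subst (r ∈_) (sym (N∁≡Y a∈X)) r∈Y) r∉N∁b)

    adjacent-to-Y⇒covers-Y : a ∈ Y → b ∈ S → E G a b → Y ⊆ N∁ b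
    adjacent-to-Y⇒covers-Y {a} {b} a∈Y b∈S ab with E? G x₀ b
    ... | yes x₀b = adjacent-to-X⇒covers-Y x₀∈X b∈S x₀b
    ... | no ¬x₀b = nonadjacent⇒N∁-⊆ b∈S ¬x₀b a∈Y (∈-N∁⁺ (proj₁ (∈-N∁⁻ a∈Y)) (E-sym G ab))

    covers-Y⇒∈X : b ∈ S → b ∉ U → Y ⊆ N∁ b → b ∈ X
    covers-Y⇒∈X {b} b∈S b∉U Y⊆N∁b with ≡-dec _≟ᵇ_ (N∁ b) Y
    ... | yes N∁b≡Y = ∈-fromDec⁺ X? (b∈S , N∁b≡Y)
    ... | no N∁b≢Y  = contradiction (∈-fromDec⁺ U? (b∈S , ⊆∧≢⇒⊂ Y⊆N∁b (N∁b≢Y ∘ sym))) b∉U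

    C-closed : a ∈ C → b ∈ ∁ U → E G a b → b ∈ C
    C-closed {a} {b} a∈C b∈∁U ab with x∈p∪q⁻ X Y a∈C | b ∈? S
    ... | inj₁ a∈X | no b∉S  = x∈p∪q⁺ (inj₂ (subst (b ∈_) (N∁≡Y a∈X) (∈-N∁⁺ b∉S ab)))
    ... | inj₂ a∈Y | no b∉S  = x∈p∪q⁺ (inj₂ (N∁-closed x₀∈S a∈Y b∉S ab))
    ... | inj₁ a∈X | yes b∈S =
      x∈p∪q⁺ (inj₁ (covers-Y⇒∈X b∈S (x∈∁p⇒x∉p b∈∁U) (adjacent-to-X⇒covers-Y a∈X b∈S ab)))
    ... | inj₂ a∈Y | yes b∈S =
      x∈p∪q⁺ (inj₁ (covers-Y⇒∈X b∈S (x∈∁p⇒x∉p b∈∁U) (adjacent-to-Y⇒covers-Y a∈Y b∈S ab)))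

    C⊆∁U : C ⊆ ∁ U
    C⊆∁U {w} w∈C with x∈p∪q⁻ X Y w∈C
    ... | inj₁ w∈X = x∉p⇒x∈∁p (λ w∈U → X∩U-empty (w , x∈p∩q⁺ (w∈X , w∈U)))
    ... | inj₂ w∈Y = x∉p⇒x∈∁p (λ w∈U → proj₁ (∈-N∁⁻ w∈Y) (proj₁ (∈-fromDec⁻ U? w∈U)))

    x₀∈C : x₀ ∈ C
    x₀∈C = x∈p∪q⁺ (inj₁ x₀∈X)

    y₀∈C : y₀ ∈ C
    y₀∈C = x∈p∪q⁺ (inj₂ y₀∈Y)

    path-to-x₀ : a ∈ C → Path G C a x₀
    path-to-x₀ {a} a∈C with x∈p∪q⁻ X Y a∈C
    ... | inj₁ a∈X = step (step (here a∈C) ay₀ y₀∈C) (E-sym G (proj₂ (∈-N∁⁻ y₀∈Y))) x₀∈C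
      where ay₀ = proj₂ (∈-N∁⁻ (subst (y₀ ∈_) (sym (N∁≡Y a∈X)) y₀∈Y))
    ... | inj₂ a∈Y = step (here a∈C) (E-sym G (proj₂ (∈-N∁⁻ a∈Y))) x₀∈C

    C-component : Component G (∁ U) C
    C-component =
      C⊆∁U , (x₀ , x₀∈C) ,
      (λ a b a∈C b∈C → Path-trans G (path-to-x₀ a∈C) (Path-sym G (path-to-x₀ b∈C))) ,
      (λ a b a∈C b∈∁U b∉C ab → b∉C (C-closed a∈C b∈∁U ab))

    U-cutset : Cutset G U
    U-cutset = x₀ , v₀ , x₀∉U , v₀∉U , Component-¬Path G C-component x₀∈C v₀∉C
      where
      v₀   = proj₁ (proj₂ x₀-deficient)
      v₀∉S = proj₁ (proj₂ (proj₂ x₀-deficient))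
      x₀∉U : x₀ ∉ U
      x₀∉U x₀∈U = X∩U-empty (x₀ , x∈p∩q⁺ (x₀∈X , x₀∈U))
      v₀∉U : v₀ ∉ U
      v₀∉U = v₀∉S ∘ proj₁ ∘ ∈-fromDec⁻ U?
      v₀∉C : v₀ ∉ C
      v₀∉C v₀∈C with x∈p∪q⁻ X Y v₀∈C
      ... | inj₁ v₀∈X = v₀∉S (proj₁ (∈-fromDec⁻ X? v₀∈X))
      ... | inj₂ v₀∈Y = proj₂ (proj₂ (proj₂ x₀-deficient)) (proj₂ (∈-N∁⁻ v₀∈Y))

    U-X-complete : u ∈ U → x ∈ X → E G u x
    U-X-complete {u} {x} u∈U x∈X = decidable-stable (E? G u x) λ ¬ux →
      let N∁u⊆N∁x = nonadjacent⇒N∁-⊆ (proj₁ (∈-fromDec⁻ X? x∈X)) ¬ux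
                      (proj₁ (Y⊂N∁ u∈U) y₀∈Y) (subst (y₀ ∈_) (sym (N∁≡Y x∈X)) y₀∈Y)
          (_ , z , z∈N∁u , z∉Y) = Y⊂N∁ u∈U
      in z∉Y (subst (z ∈_) (N∁≡Y x∈X) (N∁u⊆N∁x z∈N∁u))

    split : TripartiteSplit G S
    split =
      U , X , Y , proj₁ ∘ ∈-fromDec⁻ U? , U-cutset ,
      (x₀ , x₀∈X) , proj₁ ∘ ∈-fromDec⁻ X? , X∩U-empty ,
      (y₀ , y₀∈Y) , x∉p⇒x∈∁p ∘ proj₁ ∘ ∈-N∁⁻ ,
      C-component ,
      (λ _ _ → U-X-complete) ,
      (λ _ _ u∈U y∈Y → proj₂ (∈-N∁⁻ (proj₁ (Y⊂N∁ u∈U) y∈Y))) ,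
      (λ x _ x∈X y∈Y → proj₂ (∈-N∁⁻ (subst (_ ∈_) (sym (N∁≡Y x∈X)) y∈Y)))

  Deficient⇒split : ∃ Deficient → TripartiteSplit G S
  Deficient⇒split deficient with ∃-⊂-minimal Deficient? N∁ deficient
  ... | x₀ , x₀-deficient , x₀-minimal = Split.split x₀ x₀-deficient x₀-minimal

  minimal⇒complete : MinimalCutset G S → u ∈ S → v ∉ S → E G u v
  minimal⇒complete {u} {v} minimal u∈S v∉S = decidable-stable (E? G u v) λ ¬uv →
    split⇒¬minimal G S (Deficient⇒split (u , u∈S , v , v∉S , ¬uv)) minimal

  ¬minimal⇒split : Cutset G S → ¬ MinimalCutset G S → TripartiteSplit G S
  ¬minimal⇒split cutset ¬minimal with any? Deficient?
  ... | yes deficient = Deficient⇒split deficient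
  ... | no ∄         = contradiction (¬Deficient⇒minimal cutset (λ x d → ∄ (x , d))) ¬minimal

lemma2p4 : {n : ℕ} (G : Graph n) (S : Subset n) →
    Connected G → P4Free G → Cutset G S →
    (∀ u → u ∈ S → Σ (Subset n) λ R₁ → Σ (Subset n) λ R₂ →
        Component G (∁ S) R₁ × Component G (∁ S) R₂ × R₁ ≢ R₂ ×
        AdjTo G u R₁ × AdjTo G u R₂) →
    -- (i)
    (∀ u R → u ∈ S → Component G (∁ S) R → AdjTo G u R →
        ∀ w → w ∈ R → E G u w)
    -- (ii)
    × (∀ R → Component G (∁ S) R → ContractedP4Free G R)
    -- (iii)
    × (MinimalCutset G S → ∀ u v → u ∈ S → v ∉ S → E G u v)
    -- (iv)
    × (¬ MinimalCutset G S →
        Σ (Subset n) λ U → Σ (Subset n) λ X → Σ (Subset n) λ Y →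
          U ⊆ S × Cutset G U ×
          Nonempty X × X ⊆ S × Empty (X ∩ U) ×
          Nonempty Y × Y ⊆ ∁ S ×
          Component G (∁ U) (X ∪ Y) ×
          (∀ u x → u ∈ U → x ∈ X → E G u x) ×
          (∀ u y → u ∈ U → y ∈ Y → E G u y) ×
          (∀ x y → x ∈ X → y ∈ Y → E G x y))
lemma2p4 G S _ p4 cutset sees-two =
  (λ _ _ u∈S cR adj _ → adjacent⇒complete-to-component u∈S cR adj) ,
  (λ _ → component-contraction-P4Free) ,
  (λ minimal _ _ → minimal⇒complete minimal) ,
  ¬minimal⇒split cutset
  where open P4FreeCutset G S p4 sees-two
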